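{- Let $m\ge1$. There exist only finitely many skeletons in which the black root-face and all the finite white faces have degree at most $m$.
   Context: Planar maps are connected graphs (loops, multiple edges allowed) embedded in the oriented sphere up to orientation-preserving homeomorphism, rooted at a distinguished oriented root-edge; the infinite (root) face lies to the right of the root-edge, the other faces are finite; the degree of a face is its number of edge incidences. An Eulerian map is a rooted planar map all of whose vertices have even degree; its faces are coloured black and white so that the infinite face is white and adjacent faces have different colours (this colouring is unique). The black root-face is the black face incident to the root-edge. A face is a polygon if its number of vertices equals its degree. An Eulerian map $M$ with black root-face $R$ is a skeleton if (i) each connected component left after deleting the edges (but not the vertices) of $R$ is either a single vertex or a polygon (a cycle bounding a single black face whose number of vertices equals its degree), and (ii) every edge incident to the white root-face (infinite face) is also incident to $R$. -}

module Defs where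

import Agda.Primitive
open import Data.Nat using (ℕ; zero; suc; _+_; _*_; _≤_)
open import Data.Nat.Divisibility using (_∣_)
open import Data.Fin using (Fin; toℕ) renaming (zero to fz; suc to fs)
open import Data.Fin.Properties using (any?; all?) renaming (_≟_ to _≟ᶠ_)
import Data.Nat.Properties as ℕP
open import Data.Bool using (Bool; true; false; if_then_else_)
open import Data.Product using (Σ; ∃; _×_; _,_)
open import Data.Sum using (_⊎_)
open import Data.List using (List)
open import Data.List.Relation.Unary.Any using (Any)
open import Function using (_∘_; _⇔_; Injective)
open import Function.Bundles using (Inverse; _↔_)
open import Relation.Nullary using (Dec; does; ¬_)
open import Relation.Nullary.Decidable using (_×-dec_; _→-dec_)
open import Relation.Unary using (Pred; Decidable)
open import Relation.Binary.PropositionalEquality using (_≡_; _≢_)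
open import Relation.Binary.Construct.Closure.ReflexiveTransitive using (Star)

iter : ∀ {A : Set} → (A → A) → ℕ → A → A
iter f zero    x = x
iter f (suc k) x = f (iter f k x)

-- y lies in the orbit of x under p (orbits on Fin d have size ≤ d)
InOrbit : ∀ {d} → (Fin d → Fin d) → Fin d → Fin d → Set
InOrbit {d} p x y = Σ (Fin d) λ k → iter p (toℕ k) x ≡ y

InOrbit? : ∀ {d} (p : Fin d → Fin d) x y → Dec (InOrbit p x y)
InOrbit? p x y = any? (λ k → iter p (toℕ k) x ≟ᶠ y)

count : ∀ {d} (P : Pred (Fin d) Agda.Primitive.lzero) → Decidable P → ℕ
count {zero}  P P? = 0
count {suc d} P P? =
  (if does (P? fz) then 1 else 0) + count (λ x → P (fs x)) (λ x → P? (fs x))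

IsRep : ∀ {d} → (Fin d → Fin d) → Fin d → Set
IsRep {d} p x = (y : Fin d) → InOrbit p x y → toℕ x ≤ toℕ y

IsRep? : ∀ {d} (p : Fin d → Fin d) → Decidable (IsRep p)
IsRep? p x = all? (λ y → InOrbit? p x y →-dec (toℕ x ℕP.≤? toℕ _))

numOrbits : ∀ {d} → (Fin d → Fin d) → ℕ
numOrbits p = count (IsRep p) (IsRep? p)

orbitSize : ∀ {d} → (Fin d → Fin d) → Fin d → ℕ
orbitSize p x = count (InOrbit p x) (InOrbit? p x)

-- Darts (half-edges / oriented edges) are Fin d.  α h is the reverse of
-- the dart h; σ h is the next dart counter-clockwise around the tail of h.
-- Vertices = σ-orbits, edges = α-orbits, faces = φ-orbits with
-- φ = σ ∘ α : the orbit of h under φ is the face lying to the right of h.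

data Step {d} (σ α : Fin d → Fin d) : Fin d → Fin d → Set where
  by-σ : ∀ x → Step σ α x (σ x)
  by-α : ∀ x → Step σ α x (α x)

record Map : Set where
  field
    d       : ℕ
    σ       : Fin d → Fin d
    α       : Fin d → Fin d
    σ-inj   : Injective _≡_ _≡_ σ
    α-invol : ∀ h → α (α h) ≡ h
    α-fpf   : ∀ h → α h ≢ h
    root    : Fin d
    connected : ∀ x y → Star (Step σ α) x y
    -- planar (genus 0): V - E + F = 2 with E = d / 2
    planar : 2 * (numOrbits σ + numOrbits (σ ∘ α)) ≡ d + 4

  φ : Fin d → Fin d
  φ = σ ∘ α

  InFace : Fin d → Fin d → Set
  InFace f h = InOrbit φ f h

  -- degree of the face containing f = number of its edge incidences (darts)
  faceDeg : Fin d → ℕ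
  faceDeg f = orbitSize φ f

  VertexOfFace : Fin d → Fin d → Set
  VertexOfFace f v = IsRep σ v × ∃ λ h → InFace f h × InOrbit σ v h

  VertexOfFace? : ∀ f → Decidable (VertexOfFace f)
  VertexOfFace? f v =
    IsRep? σ v ×-dec any? (λ h → InOrbit? φ f h ×-dec InOrbit? σ v h)

  faceVerts : Fin d → ℕ
  faceVerts f = count (VertexOfFace f) (VertexOfFace? f)

  IsPolygon : Fin d → Set
  IsPolygon f = faceVerts f ≡ faceDeg f

  -- infinite (root) face: face to the right of the root dart
  InRootFace : Fin d → Set
  InRootFace h = InFace root h

  Eulerian : Set
  Eulerian = ∀ v → 2 ∣ orbitSize σ v


-- Black/white colouring of faces: constant on faces, the two sides of
-- every edge differ, the infinite face is white (false).  black = true.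
record Colouring (M : Map) : Set where
  open Map M
  field
    col      : Fin d → Bool
    col-face : ∀ h → col (φ h) ≡ col h
    col-edge : ∀ h → col (α h) ≢ col h
    col-root : col root ≡ false

module SkeletonDefs (M : Map) (C : Colouring M) where
  open Map M
  open Colouring C

  -- the black root-face is the face to the right of α root
  InR : Fin d → Set
  InR h = InFace (α root) h

  EdgeOfR : Fin d → Set
  EdgeOfR h = InR h ⊎ InR (α h)

  -- steps in the graph M with the edges of R deleted (all vertices kept):
  -- move around a vertex freely, cross an edge only if it is not in R
  data StepG' : Fin d → Fin d → Set where
    at-vertex : ∀ x → StepG' x (σ x)
    along     : ∀ x → ¬ EdgeOfR x → StepG' x (α x)

  -- tail of y lies in the same component of M - E(R) as tail of x
  Conn : Fin d → Fin d → Set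
  Conn = Star StepG'

  EdgeOfFace : Fin d → Fin d → Set
  EdgeOfFace f h = InFace f h ⊎ InFace f (α h)

  -- condition (i): each component of M - E(R) (component of the vertex at v)
  -- is a single vertex (no edges) or a polygon: the boundary cycle of a
  -- black polygonal face f, i.e. its edges are exactly the edges of f
  ComponentOK : Fin d → Set
  ComponentOK v =
    (∀ h → Conn v h → EdgeOfR h)
    ⊎ (Σ (Fin d) λ f → col f ≡ true × IsPolygon f ×
         (∀ h → (Conn v h × ¬ EdgeOfR h) ⇔ EdgeOfFace f h))

  -- condition (ii): every edge incident to the infinite face is incident to R
  OuterOK : Set
  OuterOK = ∀ h → (InRootFace h ⊎ InRootFace (α h)) → EdgeOfR h

  IsSkeletonWrt : Set
  IsSkeletonWrt = (∀ v → ComponentOK v) × OuterOK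

  DegBounded : ℕ → Set
  DegBounded m = faceDeg (α root) ≤ m
    × (∀ f → col f ≡ false → ¬ InRootFace f → faceDeg f ≤ m)

-- (the colouring of an Eulerian planar map is unique, so quantifying over
-- it existentially is the same as referring to "the" colouring)
SkeletonWithDeg≤ : ℕ → Map → Set
SkeletonWithDeg≤ m M = Map.Eulerian M ×
  Σ (Colouring M) λ C → SkeletonDefs.IsSkeletonWrt M C × SkeletonDefs.DegBounded M C m

record _≅_ (M N : Map) : Set where
  field
    iso    : Fin (Map.d M) ↔ Fin (Map.d N)
  f : Fin (Map.d M) → Fin (Map.d N)
  f = Inverse.to iso
  field
    iso-σ    : ∀ h → f (Map.σ M h) ≡ Map.σ N (f h)
    iso-α    : ∀ h → f (Map.α M h) ≡ Map.α N (f h)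
    iso-root : f (Map.root M) ≡ Map.root N

-- A white dart g reaches, within fewer than m steps along its face, a dart whose reverse
-- lies on the black root-face R.  On the root face this is condition (ii).  If a finite white
-- face W avoided R, then by condition (i) its component in M - E(R) is a black polygon f, and
-- since a polygon meets each vertex only once, the darts of W together with their reverses
-- are closed under σ and α; by connectivity this set would contain the darts of R, which W
-- avoids.  So there are at most m · deg R ≤ m² white darts and, as α swaps the colours,
-- at most 2m² darts, and rooted maps with boundedly many darts are finitely many.
module Submission where

open import Defs
open import Level using (0ℓ)
open import Data.Bool using (true; false; not)
import Data.Bool as Bool
open import Data.Bool.Properties using (¬-not)
open import Data.Empty using (⊥; ⊥-elim)
open import Data.Fin using (Fin; toℕ; fromℕ; fromℕ<) renaming (zero to fz; suc to fs)
open import Data.Fin.Properties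
  using (suc-injective; toℕ-injective; toℕ-fromℕ; toℕ-fromℕ<; toℕ-inject; toℕ<n;
         ¬∀⟶∃¬-smallest; ¬∀⟶∃¬; pigeonhole; any?; all?)
  renaming (_≟_ to _≟ᶠ_)
open import Data.Nat using (ℕ; zero; suc; _+_; _*_; _∸_; _≤_; _<_; _≥_; z≤n; s≤s; s≤s⁻¹)
import Data.Nat as ℕ
open import Data.Nat.Properties hiding (suc-injective)
open import Data.List using (List; []; [_]; concatMap; cartesianProductWith; upTo; allFin)
open import Data.List.Membership.Propositional.Properties using (∈-upTo⁺; ∈-allFin)
open import Data.List.Relation.Unary.Any using (Any; here)
import Data.List.Relation.Unary.Any as Any
open import Data.List.Relation.Unary.Any.Properties using (concatMap⁺; cartesianProductWith⁺)
open import Data.Product using (Σ; ∃; _×_; _,_; proj₁; proj₂)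
open import Data.Vec.Functional using (Vector)
import Data.Vec.Functional as Vector
open import Function.Construct.Identity using (↔-id)
open import Data.Sum using (_⊎_; inj₁; inj₂; [_,_]′)
open import Data.Unit using (tt)
open import Function using (_∘_; id; const; Injective; _⇔_; Equivalence)
open import Relation.Nullary using (¬_; Dec; yes; no)
open import Relation.Nullary.Decidable using (decidable-stable; ¬?; _×-dec_; _⊎-dec_; _→-dec_; map′)
open import Relation.Unary using (Pred; Decidable; U; ｛_｝; _∩_; _∖_; _⊆_; _≐_)
open import Relation.Unary.Properties using (U?; ∁?; _∩?_)
open import Relation.Binary.PropositionalEquality
  using (_≡_; _≢_; _≗_; refl; sym; trans; cong; cong₂; subst; module ≡-Reasoning)
open import Relation.Binary.Definitions
  using (tri<; tri≈; tri>; _Respects_) renaming (Decidable to Decidable₂)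
open import Relation.Binary.Construct.Closure.ReflexiveTransitive using (Star; ε; _◅_; _◅◅_; gmap)

count-cong : {d : ℕ} {P Q : Pred (Fin d) 0ℓ} (P? : Decidable P) (Q? : Decidable Q) →
             P ≐ Q → count P P? ≡ count Q Q?
count-cong {zero}  P? Q? P≐Q = refl
count-cong {suc d} P? Q? (P⊆Q , Q⊆P) with P? fz | Q? fz
... | yes _  | yes _ = cong suc (count-cong (P? ∘ fs) (Q? ∘ fs) (P⊆Q , Q⊆P))
... | no _   | no _  = count-cong (P? ∘ fs) (Q? ∘ fs) (P⊆Q , Q⊆P)
... | yes p  | no ¬q = ⊥-elim (¬q (P⊆Q p))
... | no ¬p  | yes q = ⊥-elim (¬p (Q⊆P q))

count-mono : {d : ℕ} {P Q : Pred (Fin d) 0ℓ} (P? : Decidable P) (Q? : Decidable Q) →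
             P ⊆ Q → count P P? ≤ count Q Q?
count-mono {zero}  P? Q? P⊆Q = z≤n
count-mono {suc d} P? Q? P⊆Q with P? fz | Q? fz
... | yes _ | yes _ = s≤s (count-mono (P? ∘ fs) (Q? ∘ fs) P⊆Q)
... | no _  | no _  = count-mono (P? ∘ fs) (Q? ∘ fs) P⊆Q
... | no _  | yes _ = m≤n⇒m≤1+n (count-mono (P? ∘ fs) (Q? ∘ fs) P⊆Q)
... | yes p | no ¬q = ⊥-elim (¬q (P⊆Q p))

count-universal : {d : ℕ} {P : Pred (Fin d) 0ℓ} (P? : Decidable P) → (∀ x → P x) → count P P? ≡ d
count-universal {zero}  P? all = refl
count-universal {suc d} P? all with P? fz
... | yes _ = cong suc (count-universal (P? ∘ fs) (all ∘ fs))
... | no ¬p = ⊥-elim (¬p (all fz))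

count-empty : {d : ℕ} {P : Pred (Fin d) 0ℓ} (P? : Decidable P) → (∀ x → ¬ P x) → count P P? ≡ 0
count-empty {zero}  P? none = refl
count-empty {suc d} P? none with P? fz
... | yes p = ⊥-elim (none fz p)
... | no _  = count-empty (P? ∘ fs) (none ∘ fs)

count-split : {d : ℕ} {P A : Pred (Fin d) 0ℓ} (P? : Decidable P) (A? : Decidable A) →
              count P P? ≡ count (P ∩ A) (P? ∩? A?) + count (P ∖ A) (P? ∩? ∁? A?)
count-split {zero}  P? A? = refl
count-split {suc d} P? A? with P? fz | A? fz
... | yes _ | yes _ = cong suc (count-split (P? ∘ fs) (A? ∘ fs))
... | yes _ | no _  = trans (cong suc (count-split (P? ∘ fs) (A? ∘ fs))) (sym (+-suc _ _))
... | no _  | _     = count-split (P? ∘ fs) (A? ∘ fs)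

count-singleton : {d : ℕ} (a : Fin d) → count ｛ a ｝ (a ≟ᶠ_) ≡ 1
count-singleton {suc d} fz = cong suc (count-empty {d} ((fz ≟ᶠ_) ∘ fs) λ _ ())
count-singleton (fs a)    =
  trans (count-cong ((fs a ≟ᶠ_) ∘ fs) (a ≟ᶠ_) (suc-injective , cong fs)) (count-singleton a)

count-remove : {d : ℕ} {P : Pred (Fin d) 0ℓ} (P? : Decidable P) {a : Fin d} → P a →
               count P P? ≡ suc (count (P ∖ ｛ a ｝) (P? ∩? ∁? (a ≟ᶠ_)))
count-remove {P = P} P? {a} pa = begin
  count P P?                              ≡⟨ count-split P? (a ≟ᶠ_) ⟩
  count (P ∩ ｛ a ｝) (P? ∩? (a ≟ᶠ_)) + rest ≡⟨ cong (_+ rest) (count-cong _ (a ≟ᶠ_) a-only) ⟩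
  count ｛ a ｝ (a ≟ᶠ_) + rest               ≡⟨ cong (_+ rest) (count-singleton a) ⟩
  suc rest                                ∎
  where
    open ≡-Reasoning
    rest = count (P ∖ ｛ a ｝) (P? ∩? ∁? (a ≟ᶠ_))
    a-only : P ∩ ｛ a ｝ ≐ ｛ a ｝
    a-only = proj₂ , λ { refl → pa , refl }

count-< : {d : ℕ} {P Q : Pred (Fin d) 0ℓ} (P? : Decidable P) (Q? : Decidable Q) {a : Fin d} →
          P ⊆ Q → Q a → ¬ P a → count P P? < count Q Q?
count-< P? Q? {a} P⊆Q qa ¬pa = ≤-trans
  (s≤s (count-mono P? (Q? ∩? ∁? (a ≟ᶠ_)) λ p → P⊆Q p , λ { refl → ¬pa p }))
  (≤-reflexive (sym (count-remove Q? qa)))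

count-injective : ∀ {n m} {P : Pred (Fin n) 0ℓ} {Q : Pred (Fin m) 0ℓ}
                  (P? : Decidable P) (Q? : Decidable Q) (f : ∀ x → P x → Fin m) →
                  (∀ x p → Q (f x p)) → (∀ x y p q → f x p ≡ f y q → x ≡ y) →
                  count P P? ≤ count Q Q?
count-injective {zero}  P? Q? f f∈Q f-inj = z≤n
count-injective {suc n} P? Q? f f∈Q f-inj with P? fz
... | no _  = count-injective (P? ∘ fs) Q? (f ∘ fs) (f∈Q ∘ fs)
                (λ x y p q e → suc-injective (f-inj _ _ p q e))
... | yes p = ≤-trans
  (s≤s (count-injective (P? ∘ fs) (Q? ∩? ∁? (f fz p ≟ᶠ_)) (f ∘ fs)
          (λ x q → f∈Q (fs x) q , λ e → fz≢fs (f-inj _ _ p q e))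
          (λ x y p q e → suc-injective (f-inj _ _ p q e))))
  (≤-reflexive (sym (count-remove Q? (f∈Q fz p))))
  where
    fz≢fs : ∀ {x : Fin n} → fz ≢ fs x
    fz≢fs ()

count-cover : {d : ℕ} (m : ℕ) {P : Pred (Fin d) 0ℓ} (P? : Decidable P)
              {Q : ℕ → Pred (Fin d) 0ℓ} (Q? : ∀ j → Decidable (Q j)) {c : ℕ} →
              (∀ j → count (Q j) (Q? j) ≤ c) → (∀ {x} → P x → ∃ λ j → j < m × Q j x) →
              count P P? ≤ m * c
count-cover zero    P? Q? bound cover =
  ≤-reflexive (count-empty P? λ x p → n≮0 (proj₁ (proj₂ (cover p))))
count-cover (suc m) {P} P? {Q} Q? {c} bound cover = begin
  count P P?                                                  ≡⟨ count-split P? (Q? m) ⟩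
  count (P ∩ Q m) (P? ∩? Q? m) + count (P ∖ Q m) (P? ∩? ∁? (Q? m))
    ≤⟨ +-mono-≤ (≤-trans (count-mono (P? ∩? Q? m) (Q? m) proj₂) (bound m))
                (count-cover m (P? ∩? ∁? (Q? m)) Q? bound cover-below-m) ⟩
  c + m * c                                                   ∎
  where
    open ≤-Reasoning
    cover-below-m : ∀ {x} → (P ∖ Q m) x → ∃ λ j → j < m × Q j x
    cover-below-m (p , ¬q) with cover p
    ... | j , j<1+m , qj = j , ≤∧≢⇒< (s≤s⁻¹ j<1+m) (λ { refl → ¬q qj }) , qj

count-≤ : {d : ℕ} {P : Pred (Fin d) 0ℓ} (P? : Decidable P) → count P P? ≤ d
count-≤ P? = ≤-trans (count-mono P? U? _) (≤-reflexive (count-universal U? _))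

least-witness : {P : Pred ℕ 0ℓ} → Decidable P → ∀ {n} → P n → ∃ λ j → P j × (∀ i → i < j → ¬ P i)
least-witness {P} P? {n} pn
  with ¬∀⟶∃¬-smallest (suc n) (λ i → ¬ P (toℕ i)) (λ i → ¬? (P? (toℕ i)))
         (λ none → none (fromℕ n) (subst P (sym (toℕ-fromℕ n)) pn))
... | j , ¬¬pj , below = toℕ j , decidable-stable (P? (toℕ j)) ¬¬pj , λ i i<j →
  subst (¬_ ∘ P) (trans (toℕ-inject (fromℕ< i<j)) (toℕ-fromℕ< i<j)) (below (fromℕ< i<j))

module _ {A : Set} where

  iter-+ : (f : A → A) → ∀ m n x → iter f (m + n) x ≡ iter f m (iter f n x)
  iter-+ f zero    n x = refl
  iter-+ f (suc m) n x = cong f (iter-+ f m n x)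

  iter-cong : {f g : A → A} → f ≗ g → ∀ n → iter f n ≗ iter g n
  iter-cong f≗g zero    x = refl
  iter-cong {f} f≗g (suc n) x = trans (cong f (iter-cong f≗g n x)) (f≗g _)

  iter-injective : {f : A → A} → Injective _≡_ _≡_ f → ∀ n → Injective _≡_ _≡_ (iter f n)
  iter-injective f-inj zero    e = e
  iter-injective f-inj (suc n) e = iter-injective f-inj n (f-inj e)

  iter-periodic : (f : A → A) {q : ℕ} {x : A} → iter f q x ≡ x → ∀ k → iter f (k * q) x ≡ x
  iter-periodic f         per zero    = refl
  iter-periodic f {q} {x} per (suc k) =
    trans (iter-+ f q (k * q) x) (trans (cong (iter f q) (iter-periodic f per k)) per)

module Orbits {d : ℕ} (p : Fin d → Fin d) (p-injective : Injective _≡_ _≡_ p) where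

  Orbit : Fin d → Fin d → Set
  Orbit x y = ∃ λ n → iter p n x ≡ y

  DistinctIterates : Fin d → ℕ → Set
  DistinctIterates x j = ∀ a b → a < b → b ≤ j → iter p a x ≢ iter p b x

  iter-cancel : ∀ {x a b} → a ≤ b → iter p a x ≡ iter p b x → iter p (b ∸ a) x ≡ x
  iter-cancel {x} {a} {b} a≤b e = sym (iter-injective p-injective a (begin
    iter p a x                  ≡⟨ e ⟩
    iter p b x                  ≡⟨ cong (λ k → iter p k x) (sym (m+[n∸m]≡n a≤b)) ⟩
    iter p (a + (b ∸ a)) x      ≡⟨ iter-+ p a (b ∸ a) x ⟩
    iter p a (iter p (b ∸ a) x) ∎))
    where open ≡-Reasoning

  period : ∀ x → ∃ λ q → iter p (suc q) x ≡ x
  period x with pigeonhole (n<1+n d) (λ (i : Fin (suc d)) → iter p (toℕ i) x)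
  ... | i , j , i<j , e with toℕ j ∸ toℕ i | m<n⇒0<n∸m i<j | iter-cancel (<⇒≤ i<j) e
  ...   | suc q | _ | per = q , per

  Orbit-trans : ∀ {x y z} → Orbit x y → Orbit y z → Orbit x z
  Orbit-trans {x} (a , refl) (b , refl) = b + a , iter-+ p b a x

  Orbit-sym : ∀ {x y} → Orbit x y → Orbit y x
  Orbit-sym {x} (n , refl) with period x
  ... | q , per = n * q , (begin
    iter p (n * q) (iter p n x) ≡⟨ sym (iter-+ p (n * q) n x) ⟩
    iter p (n * q + n) x        ≡⟨ cong (λ k → iter p k x) (+-comm (n * q) n) ⟩
    iter p (n + n * q) x        ≡⟨ cong (λ k → iter p k x) (sym (*-suc n q)) ⟩
    iter p (n * suc q) x        ≡⟨ iter-periodic p per n ⟩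
    x                           ∎)
    where open ≡-Reasoning

  predecessor : ∀ {x y} → Orbit x y → ∃ λ z → Orbit x z × p z ≡ y
  predecessor {y = y} o with period y
  ... | q , per = iter p q y , Orbit-trans o (q , refl) , per

  least-hit : {S : Pred (Fin d) 0ℓ} → Decidable S → ∀ {x} n → S (iter p n x) →
              ∃ λ j → S (iter p j x) × DistinctIterates x j
  least-hit {S} S? {x} n s with least-witness (λ k → S? (iter p k x)) {n} s
  ... | j , sj , below = j , sj , distinct
    where
      distinct : DistinctIterates x j
      distinct a b a<b b≤j e = below (j ∸ c) (∸-monoʳ-< (m<n⇒0<n∸m a<b) c≤j)
                                 (subst S (sym shift) sj)
        where
          c = b ∸ a
          c≤j : c ≤ j
          c≤j = ≤-trans (m∸n≤m b a) b≤j
          shift : iter p (j ∸ c) x ≡ iter p j x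
          shift = begin
            iter p (j ∸ c) x              ≡⟨ cong (iter p (j ∸ c)) (sym (iter-cancel (<⇒≤ a<b) e)) ⟩
            iter p (j ∸ c) (iter p c x)   ≡⟨ sym (iter-+ p (j ∸ c) c x) ⟩
            iter p (j ∸ c + c) x          ≡⟨ cong (λ k → iter p k x) (m∸n+n≡m c≤j) ⟩
            iter p j x                    ∎
            where open ≡-Reasoning

  count-distinct-iterates : {Q : Pred (Fin d) 0ℓ} (Q? : Decidable Q) → ∀ {x j} →
    DistinctIterates x j → (∀ i → i ≤ j → Q (iter p i x)) → suc j ≤ count Q Q?
  count-distinct-iterates Q? {x} {j} distinct in-Q = ≤-trans
    (≤-reflexive (sym (count-universal {suc j} U? _)))
    (count-injective U? Q? (λ i _ → iter p (toℕ i) x) (λ i _ → in-Q (toℕ i) (s≤s⁻¹ (toℕ<n i)))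
       λ a b _ _ e → toℕ-injective (distinct-indices a b e))
    where
      distinct-indices : ∀ (a b : Fin (suc j)) → iter p (toℕ a) x ≡ iter p (toℕ b) x → toℕ a ≡ toℕ b
      distinct-indices a b e with <-cmp (toℕ a) (toℕ b)
      ... | tri< a<b _ _ = ⊥-elim (distinct _ _ a<b (s≤s⁻¹ (toℕ<n b)) e)
      ... | tri≈ _ a≡b _ = a≡b
      ... | tri> _ _ b<a = ⊥-elim (distinct _ _ b<a (s≤s⁻¹ (toℕ<n a)) (sym e))

  Orbit⇒InOrbit : ∀ {x y} → Orbit x y → InOrbit p x y
  Orbit⇒InOrbit {x} {y} (n , e) with least-hit (_≟ᶠ y) n e
  ... | j , hit , distinct = fromℕ< j<d , trans (cong (λ k → iter p k x) (toℕ-fromℕ< j<d)) hit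
    where
      j<d : j < d
      j<d = ≤-trans (count-distinct-iterates U? distinct (λ _ _ → tt)) (count-≤ U?)

  InOrbit⇒Orbit : ∀ {x y} → InOrbit p x y → Orbit x y
  InOrbit⇒Orbit (k , e) = toℕ k , e

  InOrbit-trans : ∀ {x y z} → InOrbit p x y → InOrbit p y z → InOrbit p x z
  InOrbit-trans o o′ = Orbit⇒InOrbit (Orbit-trans (InOrbit⇒Orbit o) (InOrbit⇒Orbit o′))

  InOrbit-sym : ∀ {x y} → InOrbit p x y → InOrbit p y x
  InOrbit-sym o = Orbit⇒InOrbit (Orbit-sym (InOrbit⇒Orbit o))

  IsRep-unique : ∀ {v w h} → IsRep p v → IsRep p w → InOrbit p v h → InOrbit p w h → v ≡ w
  IsRep-unique v-rep w-rep vh wh = toℕ-injective (≤-antisym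
    (v-rep _ (InOrbit-trans vh (InOrbit-sym wh)))
    (w-rep _ (InOrbit-trans wh (InOrbit-sym vh))))

  hit-within-orbitSize : {S : Pred (Fin d) 0ℓ} → Decidable S → ∀ {x} n → S (iter p n x) →
                         ∃ λ j → j < orbitSize p x × S (iter p j x)
  hit-within-orbitSize S? {x} n s with least-hit S? n s
  ... | j , hit , distinct =
    j , count-distinct-iterates (InOrbit? p x) distinct (λ i _ → Orbit⇒InOrbit (i , refl)) , hit

respects-Star : ∀ {A : Set} {R : A → A → Set} {P : Pred A 0ℓ} → P Respects R → P Respects Star R
respects-Star resp ε        px = px
respects-Star resp (r ◅ rs) px = respects-Star resp rs (resp r px)

module MapFacts (M : Map) where
  open Map M

  α-injective : Injective _≡_ _≡_ α
  α-injective {x} {y} e = trans (sym (α-invol x)) (trans (cong α e) (α-invol y))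

  φ-injective : Injective _≡_ _≡_ φ
  φ-injective = α-injective ∘ σ-inj

  φ-α : ∀ h → φ (α h) ≡ σ h
  φ-α h = cong σ (α-invol h)

  module σ-orbits = Orbits σ σ-inj
  module φ-orbits = Orbits φ φ-injective

  InFace-refl : ∀ {f} → InFace f f
  InFace-refl = φ-orbits.Orbit⇒InOrbit (0 , refl)

  InFace-φ : ∀ {f h} → InFace f h → InFace f (φ h)
  InFace-φ (k , e) = φ-orbits.Orbit⇒InOrbit (suc (toℕ k) , cong φ e)

  faceVerts<faceDeg : ∀ {f a b} → InFace f a → InFace f b → InOrbit σ a b → a ≢ b →
                      faceVerts f < faceDeg f
  faceVerts<faceDeg {f} {a} {b} fa fb ab a≢b = ≤-trans
    (s≤s (count-injective (VertexOfFace? f) (InOrbit? φ f ∩? ∁? (a ≟ᶠ_))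
            (λ _ vf → proj₁ (pick vf)) (λ _ vf → proj₁ (proj₂ (pick vf))) pick-injective))
    (≤-reflexive (sym (count-remove (InOrbit? φ f) fa)))
    where
      -- Every vertex of f picks a dart of f other than a: the vertex of a can pick b.
      pick : ∀ {v} → VertexOfFace f v → ∃ λ h → (InFace f ∖ ｛ a ｝) h × InOrbit σ v h
      pick (_ , h , fh , vh) with a ≟ᶠ h
      ... | no a≢h   = h , (fh , a≢h) , vh
      ... | yes refl = b , (fb , a≢b) , σ-orbits.InOrbit-trans vh ab

      pick-injective : ∀ v w (vf : VertexOfFace f v) (wf : VertexOfFace f w) →
                       proj₁ (pick vf) ≡ proj₁ (pick wf) → v ≡ w
      pick-injective v w vf wf e = σ-orbits.IsRep-unique (proj₁ vf) (proj₁ wf)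
        (proj₂ (proj₂ (pick vf))) (subst (InOrbit σ w) (sym e) (proj₂ (proj₂ (pick wf))))

  polygon-vertex-injective : ∀ {f a b} → IsPolygon f → InFace f a → InFace f b →
                             InOrbit σ a b → a ≡ b
  polygon-vertex-injective {a = a} {b} polygon fa fb ab with a ≟ᶠ b
  ... | yes a≡b = a≡b
  ... | no a≢b  = ⊥-elim (<-irrefl polygon (faceVerts<faceDeg fa fb ab a≢b))

module SkeletonFacts (M : Map) (C : Colouring M) where
  open Map M
  open Colouring C
  open SkeletonDefs M C
  open MapFacts M

  col-α : ∀ h → col (α h) ≡ not (col h)
  col-α h = ¬-not (col-edge h)

  col-InFace : ∀ {f h} → InFace f h → col h ≡ col f
  col-InFace {f} (k , refl) = col-iter (toℕ k)
    where
      col-iter : ∀ n → col (iter φ n f) ≡ col f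
      col-iter zero    = refl
      col-iter (suc n) = trans (col-face _) (col-iter n)

  InR-α-root : InR (α root)
  InR-α-root = InFace-refl

  InR⇒black : ∀ {h} → InR h → col h ≡ true
  InR⇒black r = trans (col-InFace r) (trans (col-α root) (cong not col-root))

  White : Pred (Fin d) 0ℓ
  White h = col h ≡ false

  White? : Decidable White
  White? h = col h Bool.≟ false

  black-not-white : ∀ {h} → col h ≡ true → ¬ White h
  black-not-white black white with trans (sym black) white
  ... | ()

  white-not-in-R : ∀ {h} → White h → ¬ InR h
  white-not-in-R white r = black-not-white (InR⇒black r) white

  module WhiteFaceAvoidingR (components : ∀ v → ComponentOK v) {g : Fin d}
                            (g-white : White g) (avoids : ∀ {h} → InFace g h → ¬ InR (α h)) where
    open φ-orbits using (Orbit; Orbit⇒InOrbit; predecessor)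

    W : Pred (Fin d) 0ℓ
    W = Orbit g

    W-white : ∀ {w} → W w → White w
    W-white o = trans (col-InFace (Orbit⇒InOrbit o)) g-white

    W-off-R : ∀ {w} → W w → ¬ EdgeOfR w
    W-off-R o (inj₁ r) = white-not-in-R (W-white o) r
    W-off-R o (inj₂ r) = avoids (Orbit⇒InOrbit o) r

    W-connected : ∀ n → Conn g (iter φ n g)
    W-connected zero    = ε
    W-connected (suc n) = W-connected n ◅◅ along _ (W-off-R (n , refl)) ◅ at-vertex _ ◅ ε

    W-φ : ∀ {w} → W w → W (φ w)
    W-φ (n , e) = suc n , cong φ e

    module PolygonComponent (f : Fin d) (f-black : col f ≡ true) (f-polygon : IsPolygon f)
                            (edges : ∀ h → (Conn g h × ¬ EdgeOfR h) ⇔ EdgeOfFace f h) where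

      αW⊆f : ∀ {w} → W w → InFace f (α w)
      αW⊆f {w} o@(n , refl) with Equivalence.to (edges w) (W-connected n , W-off-R o)
      ... | inj₁ fw  = ⊥-elim (black-not-white (trans (col-InFace fw) f-black) (W-white o))
      ... | inj₂ fαw = fαw

      σW⊆f : ∀ {w} → W w → InFace f (σ w)
      σW⊆f {w} o = subst (InFace f) (φ-α w) (InFace-φ (αW⊆f o))

      -- α z and σ w = σ (σ (α z)) are darts of the polygon f at the same vertex, hence equal.
      W-σα : ∀ {w} → W w → W (α (σ w))
      W-σα {w} o with predecessor o
      ... | z , oz , φz≡w = subst W z≡ασw oz
        where
          αz≡σw : α z ≡ σ w
          αz≡σw = polygon-vertex-injective f-polygon (αW⊆f oz) (σW⊆f o)
                    (σ-orbits.Orbit⇒InOrbit (2 , cong σ φz≡w))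
          z≡ασw : z ≡ α (σ w)
          z≡ασw = trans (sym (α-invol z)) (cong α αz≡σw)

      W-or-αW : Pred (Fin d) 0ℓ
      W-or-αW x = W x ⊎ W (α x)

      W-or-αW-closed : W-or-αW Respects Step σ α
      W-or-αW-closed (by-σ x) (inj₁ w)  = inj₂ (W-σα w)
      W-or-αW-closed (by-σ x) (inj₂ αw) = inj₁ (subst W (φ-α x) (W-φ αw))
      W-or-αW-closed (by-α x) (inj₁ w)  = inj₂ (subst W (sym (α-invol x)) w)
      W-or-αW-closed (by-α x) (inj₂ αw) = inj₁ αw

      absurd : ⊥
      absurd with respects-Star W-or-αW-closed (connected g (α root)) (inj₁ (0 , refl))
      ... | inj₁ w  = W-off-R w (inj₁ InR-α-root)
      ... | inj₂ αw = W-off-R αw (inj₂ (subst InR (sym (α-invol (α root))) InR-α-root))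

    absurd : ⊥
    absurd with components g
    ... | inj₁ all-in-R = W-off-R (0 , refl) (all-in-R g ε)
    ... | inj₂ (f , f-black , f-polygon , edges) =
      PolygonComponent.absurd f f-black f-polygon edges

  white-face-meets-R : (∀ v → ComponentOK v) → ∀ {g} → White g →
                       ∃ λ h → InFace g h × InR (α h)
  white-face-meets-R components {g} g-white
    with any? (λ h → InOrbit? φ g h ×-dec InOrbit? φ (α root) (α h))
  ... | yes found = found
  ... | no none   = ⊥-elim (WhiteFaceAvoidingR.absurd components g-white λ gh r → none (_ , gh , r))

  white-root-face-dart : OuterOK → ∀ {g} → White g → InRootFace g → InR (α g)
  white-root-face-dart outer g-white in-root-face =
    [ ⊥-elim ∘ white-not-in-R g-white , id ]′ (outer _ (inj₁ in-root-face))

  white-face-dart-near-R : (∀ v → ComponentOK v) → ∀ {g} → White g →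
                           ∃ λ j → j < faceDeg g × InR (α (iter φ j g))
  white-face-dart-near-R components g-white with white-face-meets-R components g-white
  ... | _ , (k , refl) , αr =
    φ-orbits.hit-within-orbitSize (λ h → InOrbit? φ (α root) (α h)) (toℕ k) αr

  white-dart-near-R : ∀ {m} → IsSkeletonWrt → DegBounded m → 1 ≤ m → ∀ {g} → White g →
                      ∃ λ j → j < m × InR (α (iter φ j g))
  white-dart-near-R {m} (components , outer) (_ , white-bounded) m≥1 {g} g-white =
    by-face (InOrbit? φ root g)
    where
      by-face : Dec (InRootFace g) → ∃ λ j → j < m × InR (α (iter φ j g))
      by-face (yes in-root-face) = 0 , m≥1 , white-root-face-dart outer g-white in-root-face
      by-face (no finite) with white-face-dart-near-R components g-white
      ... | j , j<deg , hit = j , <-≤-trans j<deg (white-bounded g g-white finite) , hit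

  white-darts-bound : ∀ {m} → IsSkeletonWrt → DegBounded m → 1 ≤ m →
                      count White White? ≤ m * faceDeg (α root)
  white-darts-bound {m} skeleton bounded m≥1 =
    count-cover m White? (λ j g → InOrbit? φ (α root) (α (iter φ j g)))
      (λ j → count-injective _ (InOrbit? φ (α root)) (λ g _ → α (iter φ j g)) (λ _ r → r)
               (λ _ _ _ _ e → iter-injective φ-injective j (α-injective e)))
      (white-dart-near-R skeleton bounded m≥1)

  darts-bound : d ≤ 2 * count White White?
  darts-bound = ≤-trans (≤-reflexive (sym (count-universal U? _)))
    (count-cover 2 U? (λ j h → White? (iter α j h))
      (λ j → count-injective _ White? (λ h _ → iter α j h) (λ _ w → w)
               (λ _ _ _ _ e → iter-injective α-injective j e))
      white-within-one-α)
    where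
      white-within-one-α : ∀ {h} → U h → ∃ λ j → j < 2 × White (iter α j h)
      white-within-one-α {h} _ with White? h
      ... | yes white = 0 , s≤s z≤n , white
      ... | no ¬white = 1 , s≤s (s≤s z≤n) , trans (col-α h) (cong not (¬-not ¬white))

skeleton-darts-bound : ∀ m → 1 ≤ m → (M : Map) → SkeletonWithDeg≤ m M → Map.d M ≤ 2 * (m * m)
skeleton-darts-bound m m≥1 M (_ , C , skeleton , bounded) = ≤-trans darts-bound
  (*-monoʳ-≤ 2 (≤-trans (white-darts-bound skeleton bounded m≥1) (*-monoʳ-≤ m (proj₁ bounded))))
  where open SkeletonFacts M C

module BoundedReachability {d : ℕ} {R : Fin d → Fin d → Set} (R? : Decidable₂ R) where

  Reach : ℕ → Fin d → Fin d → Set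
  Reach zero    x y = x ≡ y
  Reach (suc n) x y = Reach n x y ⊎ ∃ λ z → R x z × Reach n z y

  Reach? : ∀ n → Decidable₂ (Reach n)
  Reach? zero    x y = x ≟ᶠ y
  Reach? (suc n) x y = Reach? n x y ⊎-dec any? (λ z → R? x z ×-dec Reach? n z y)

  Reach⇒Star : ∀ n {x y} → Reach n x y → Star R x y
  Reach⇒Star zero    refl                 = ε
  Reach⇒Star (suc n) (inj₁ r)             = Reach⇒Star n r
  Reach⇒Star (suc n) (inj₂ (_ , xz , r)) = xz ◅ Reach⇒Star n r

  Star⇒Reach : ∀ {x y} → Star R x y → ∃ λ n → Reach n x y
  Star⇒Reach ε         = 0 , refl
  Star⇒Reach (xz ◅ rs) = suc (proj₁ (Star⇒Reach rs)) , inj₂ (_ , xz , proj₂ (Star⇒Reach rs))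

  Reach-refl : ∀ n {y} → Reach n y y
  Reach-refl zero    = refl
  Reach-refl (suc n) = inj₁ (Reach-refl n)

  Stable : Fin d → ℕ → Set
  Stable y s = ∀ x → Reach (suc s) x y → Reach s x y

  Reach-stable : ∀ {y s} → Stable y s → ∀ n {x} → Reach n x y → Reach s x y
  Reach-stable {s = s} stable zero    refl                = Reach-refl s
  Reach-stable         stable (suc n) (inj₁ r)            = Reach-stable stable n r
  Reach-stable         stable (suc n) (inj₂ (z , xz , r)) =
    stable _ (inj₂ (z , xz , Reach-stable stable n r))

  -- Until the chain Reach 0 ⊆ Reach 1 ⊆ … stabilises, it grows by at least one element per step.
  grows-or-stabilises : ∀ y k → k ≤ count (λ x → Reach k x y) (λ x → Reach? k x y) ⊎ ∃ (Stable y)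
  grows-or-stabilises y zero = inj₁ z≤n
  grows-or-stabilises y (suc k) with grows-or-stabilises y k
  ... | inj₂ stable = inj₂ stable
  ... | inj₁ k≤count with all? (λ x → Reach? (suc k) x y →-dec Reach? k x y)
  ...   | yes stable = inj₂ (k , stable)
  ...   | no unstable with ¬∀⟶∃¬ d _ (λ x → Reach? (suc k) x y →-dec Reach? k x y) unstable
  ...     | x , new = inj₁ (≤-trans (s≤s k≤count)
    (count-< (λ x → Reach? k x y) (λ x → Reach? (suc k) x y) inj₁
      (decidable-stable (Reach? (suc k) x y) (λ ¬r → new (⊥-elim ∘ ¬r))) (new ∘ const)))

  stabilises : ∀ y → ∃ (Stable y)
  stabilises y with grows-or-stabilises y (suc d)
  ... | inj₁ too-many = ⊥-elim (<⇒≱ too-many (count-≤ (λ x → Reach? (suc d) x y)))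
  ... | inj₂ stable   = stable

Star? : ∀ {d} {R : Fin d → Fin d → Set} → Decidable₂ R → Decidable₂ (Star R)
Star? {R = R} R? x y = decide (stabilises y)
  where
    open BoundedReachability R?
    decide : ∃ (Stable y) → Dec (Star R x y)
    decide (s , stable) =
      map′ (Reach⇒Star s) (λ r → Reach-stable stable _ (proj₂ (Star⇒Reach r))) (Reach? s x y)

Step? : ∀ {d} (σ α : Fin d → Fin d) → Decidable₂ (Step σ α)
Step? σ α x y with σ x ≟ᶠ y | α x ≟ᶠ y
... | yes refl | _        = yes (by-σ x)
... | no _     | yes refl = yes (by-α x)
... | no σx≢y  | no αx≢y  = no λ { (by-σ _) → σx≢y refl ; (by-α _) → αx≢y refl }

MapAxioms : (d : ℕ) (σ α : Fin d → Fin d) → Set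
MapAxioms d σ α = Injective _≡_ _≡_ σ × (∀ h → α (α h) ≡ h) × (∀ h → α h ≢ h)
                × (∀ x y → Star (Step σ α) x y) × 2 * (numOrbits σ + numOrbits (σ ∘ α)) ≡ d + 4

MapAxioms? : ∀ d σ α → Dec (MapAxioms d σ α)
MapAxioms? d σ α =
  map′ (λ inj {x} {y} → inj x y) (λ inj x y → inj) (all? λ x → all? λ y → σ x ≟ᶠ σ y →-dec x ≟ᶠ y)
  ×-dec all? (λ h → α (α h) ≟ᶠ h) ×-dec all? (λ h → ¬? (α h ≟ᶠ h))
  ×-dec all? (λ x → all? (Star? (Step? σ α) x))
  ×-dec 2 * (numOrbits σ + numOrbits (σ ∘ α)) ℕ.≟ d + 4

toMap : ∀ {d σ α} → MapAxioms d σ α → Fin d → Map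
toMap {d} {σ} {α} (σ-inj , α-invol , α-fpf , connected , planar) root = record
  { d = d ; σ = σ ; α = α ; σ-inj = σ-inj ; α-invol = α-invol ; α-fpf = α-fpf
  ; root = root ; connected = connected ; planar = planar }

mapAxioms : (M : Map) → MapAxioms (Map.d M) (Map.σ M) (Map.α M)
mapAxioms M = σ-inj , α-invol , α-fpf , connected , planar
  where open Map M

numOrbits-cong : ∀ {d} {p q : Fin d → Fin d} → p ≗ q → numOrbits p ≡ numOrbits q
numOrbits-cong {p = p} {q} p≗q = count-cong (IsRep? p) (IsRep? q)
  ((λ rep y o → rep y (InOrbit-cong (sym ∘ p≗q) o)) , (λ rep y o → rep y (InOrbit-cong p≗q o)))
  where
    InOrbit-cong : ∀ {p q : Fin _ → Fin _} → p ≗ q → ∀ {x y} → InOrbit p x y → InOrbit q x y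
    InOrbit-cong p≗q {x} (k , e) = k , trans (sym (iter-cong p≗q (toℕ k) x)) e

MapAxioms-resp-≗ : ∀ {d σ σ′ α α′} → σ ≗ σ′ → α ≗ α′ → MapAxioms d σ α → MapAxioms d σ′ α′
MapAxioms-resp-≗ {d} {σ} {σ′} {α} {α′} σ≗σ′ α≗α′ (σ-inj , α-invol , α-fpf , connected , planar) =
    (λ e → σ-inj (trans (σ≗σ′ _) (trans e (sym (σ≗σ′ _)))))
  , (λ h → trans (sym (trans (cong α (α≗α′ h)) (α≗α′ _))) (α-invol h))
  , (λ h e → α-fpf h (trans (α≗α′ h) e))
  , (λ x y → gmap id step (connected x y))
  , trans (cong (2 *_) (sym (cong₂ _+_ (numOrbits-cong σ≗σ′) (numOrbits-cong φ≗φ′)))) planar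
  where
    step : ∀ {x y} → Step σ α x y → Step σ′ α′ x y
    step (by-σ x) = subst (Step σ′ α′ x) (sym (σ≗σ′ x)) (by-σ x)
    step (by-α x) = subst (Step σ′ α′ x) (sym (α≗α′ x)) (by-α x)
    φ≗φ′ : σ ∘ α ≗ σ′ ∘ α′
    φ≗φ′ h = trans (σ≗σ′ (α h)) (cong σ′ (α≗α′ h))

functions : ∀ n d → List (Vector (Fin d) n)
functions zero    d = [ Vector.[] ]
functions (suc n) d = cartesianProductWith Vector._∷_ (allFin d) (functions n d)

functions-complete : ∀ n d (f : Vector (Fin d) n) → Any (_≗ f) (functions n d)
functions-complete zero    d f = here λ ()
functions-complete (suc n) d f =
  cartesianProductWith⁺ Vector._∷_ (λ { refl g≗f → λ { fz → refl ; (fs i) → g≗f i } })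
    (∈-allFin (f fz)) (functions-complete n d (f ∘ fs))

mapsWith : ∀ d (σ α : Fin d → Fin d) → Fin d → List Map
mapsWith d σ α root with MapAxioms? d σ α
... | yes axioms = [ toMap axioms root ]
... | no _       = []

mapsOfSize : ℕ → List Map
mapsOfSize d = concatMap (λ σ → concatMap (λ α → concatMap (mapsWith d σ α) (allFin d))
                                          (functions d d))
                         (functions d d)

mapsUpTo : ℕ → List Map
mapsUpTo D = concatMap mapsOfSize (upTo (suc D))

mapsWith-complete : (M : Map) → ∀ {σ α} → σ ≗ Map.σ M → α ≗ Map.α M →
                    Any (M ≅_) (mapsWith (Map.d M) σ α (Map.root M))
mapsWith-complete M {σ} {α} σ≗ α≗ with MapAxioms? (Map.d M) σ α
... | yes _ = here record { iso = ↔-id _ ; iso-σ = sym ∘ σ≗ ; iso-α = sym ∘ α≗ ; iso-root = refl }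
... | no ¬axioms = ⊥-elim (¬axioms (MapAxioms-resp-≗ (sym ∘ σ≗) (sym ∘ α≗) (mapAxioms M)))

mapsOfSize-complete : (M : Map) → Any (M ≅_) (mapsOfSize (Map.d M))
mapsOfSize-complete M =
  concatMap⁺ _ (Any.map (λ σ≗ →
    concatMap⁺ _ (Any.map (λ α≗ →
      concatMap⁺ _ (Any.map (λ { refl → mapsWith-complete M σ≗ α≗ }) (∈-allFin root)))
    (functions-complete d d α)))
  (functions-complete d d σ))
  where open Map M

mapsUpTo-complete : ∀ D (M : Map) → Map.d M ≤ D → Any (M ≅_) (mapsUpTo D)
mapsUpTo-complete D M d≤D =
  concatMap⁺ mapsOfSize (Any.map (λ { refl → mapsOfSize-complete M }) (∈-upTo⁺ (s≤s d≤D)))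

lemma5p5 : (m : ℕ) → m ≥ 1 →
    Σ (List Map) λ L → (M : Map) → SkeletonWithDeg≤ m M → Any (M ≅_) L
lemma5p5 m m≥1 = mapsUpTo (2 * (m * m)) , λ M skeleton →
  mapsUpTo-complete _ M (skeleton-darts-bound m m≥1 M skeleton)
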